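{- Let $C>0$, let $k>1$ be an integer, and let $T=C/k$ (so $r=kT/C=1$). Then the online algorithm $\textsc{FlushAll}$ is $3$-competitive in the discrete $k$-wallet model $\mathcal{M}^{C,k}_T$: there is a constant $c$ depending only on the model parameters such that for every transaction sequence $\mathsf{Tx}$ with all values at most $T$, $V_{\mathrm{OPT}}(\mathsf{Tx}) \le 3\, V_{\textsc{FlushAll}}(\mathsf{Tx}) + c$.
   Context: Discrete $k$-wallet model $\mathcal{M}^{C,k}_T$: Time is divided into discrete slots $t=1,2,\dots$. A transaction sequence is $\mathsf{Tx}=(\mathsf{tx}_1,\dots,\mathsf{tx}_n)$, where $\mathsf{tx}_t\in[0,T]$ is the value of the transaction arriving at slot $t$ (value $0$ means no transaction). A total collateral $C$ is divided into $k$ wallets, each of capacity $C/k$. Each wallet is either online with some available (uncommitted) collateral $R\in[0,C/k]$, or offline. When a transaction of value $v$ arrives, the policy must immediately either settle it, using an online wallet with $R\ge v$ (whose available collateral becomes $R-v$), or discard it. At any time $t$ the policy may flush a wallet; the wallet is then offline during the slots of the interval $(t,t+F]$ (with $F$ a fixed positive integer flush period), after which it is online again with available collateral reset to $C/k$. For a policy $\mathrm{A}$, $V_{\mathrm{A}}(\mathsf{Tx})$ denotes the total value of transactions it settles. An algorithm is online if its decisions at time $N$ depend only on $\mathsf{tx}_1,\dots,\mathsf{tx}_N$. $\mathrm{OPT}$ denotes an optimal offline $k$-wallet policy, i.e. $V_{\mathrm{OPT}}(\mathsf{Tx})$ is the maximum settled value achievable by any $k$-wallet policy with full knowledge of $\mathsf{Tx}$.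 An algorithm $\mathrm{A}$ is $\alpha$-competitive in this model if for every sequence $\mathsf{Tx}$ with values at most $T$, $V_{\mathrm{OPT}}(\mathsf{Tx})\le \alpha V_{\mathrm{A}}(\mathsf{Tx})+O(1)$, where the $O(1)$ constant may depend on $C,k,T$ (and $F$) but not on $\mathsf{Tx}$ or its length. Algorithm $\textsc{FlushAll}$: the wallets are placed in a fixed order $W_1,\dots,W_k$. Each arriving transaction is settled by the first wallet in this order that has enough available collateral to fit it (first fit). When a transaction arrives that fits in no wallet, it is discarded and all $k$ wallets are flushed simultaneously (so all transactions arriving during the following flush period are discarded); afterwards the process repeats.
   Formalization: The total collateral $C$ and the transaction values $\mathsf{tx}_t$ are rational rather than real. -}

module Defs where

open import Data.Rational using (ℚ; 0ℚ; _+_; _-_; _*_; _≤_; _≤?_; _/_)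
open import Data.Integer using (+_)
open import Data.Nat as ℕ using (ℕ; zero; suc; NonZero)
open import Data.Fin using (Fin; zero; suc)
open import Data.Vec using (Vec; []; _∷_; replicate; lookup; zipWith; tabulate)
open import Data.Maybe using (Maybe; nothing; just)
import Data.Maybe as Maybe
open import Data.Bool using (Bool; true; false; if_then_else_; _∨_)
open import Data.List using (List; []; _∷_)
open import Data.Unit using (⊤)
open import Data.Empty using (⊥)
open import Relation.Nullary using (yes; no)

cap : ℚ → (k : ℕ) → .{{_ : NonZero k}} → ℚ
cap C k = C * ((+ 1) / k)

-- State of a single wallet *during* the current slot.
--   online R  : online with available (uncommitted) collateral R
--   offline n : offline in the current slot and the next (n - 1) slots;
--               afterwards online again with full capacity.
data WState : Set where
  online  : ℚ → WState
  offline : ℕ → WState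

record Decision (k : ℕ) : Set where
  constructor dec
  field
    settle : Maybe (Fin k)
    flush  : Fin k → Bool
open Decision public

initial : (k : ℕ) → ℚ → Vec WState k
initial k W = replicate k (online W)

Fits : ℚ → WState → Set
Fits v (online R)  = v ≤ R
Fits v (offline _) = ⊥

ValidSettle : ∀ {k} → Vec WState k → ℚ → Maybe (Fin k) → Set
ValidSettle s v nothing  = ⊤
ValidSettle s v (just i) = Fits v (lookup s i)

gain : ∀ {k} → ℚ → Maybe (Fin k) → ℚ
gain v nothing  = 0ℚ
gain v (just _) = v

pay : ℚ → WState → WState
pay v (online R)  = online (R - v)
pay v (offline n) = offline n

settleAt : ∀ {k} → Vec WState k → Fin k → ℚ → Vec WState k
settleAt (w ∷ ws) zero    v = pay v w ∷ ws
settleAt (w ∷ ws) (suc i) v = w ∷ settleAt ws i v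

applySettle : ∀ {k} → Vec WState k → ℚ → Maybe (Fin k) → Vec WState k
applySettle s v nothing  = s
applySettle s v (just i) = settleAt s i v

tick : ℚ → WState → WState
tick W (online R)             = online R
tick W (offline zero)         = online W
tick W (offline (suc zero))   = online W
tick W (offline (suc (suc n))) = offline (suc n)

endSlot : ℚ → ℕ → Bool → WState → WState
endSlot W F true  w = offline F
endSlot W F false w = tick W w

step : ∀ {k} → ℚ → ℕ → Vec WState k → ℚ → Decision k → Vec WState k
step W F s v d = zipWith (endSlot W F) (tabulate (flush d)) (applySettle s v (settle d))

data Run {k : ℕ} (W : ℚ) (F : ℕ) : Vec WState k → List ℚ → List (Decision k) → Set where
  []  : ∀ {s} → Run W F s [] []
  _∷_ : ∀ {s v vs d ds} → ValidSettle s v (settle d) →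
        Run W F (step W F s v d) vs ds → Run W F s (v ∷ vs) (d ∷ ds)

value : ∀ {k} → ℚ → ℕ → Vec WState k → List ℚ → List (Decision k) → ℚ
value W F s (v ∷ vs) (d ∷ ds) = gain v (settle d) + value W F (step W F s v d) vs ds
value W F s _ _ = 0ℚ

firstFit : ∀ {k} → Vec WState k → ℚ → Maybe (Fin k)
firstFit [] v = nothing
firstFit (online R ∷ ws) v with v ≤? R
... | yes _ = just zero
... | no  _ = Maybe.map suc (firstFit ws v)
firstFit (offline _ ∷ ws) v = Maybe.map suc (firstFit ws v)

anyOffline : ∀ {k} → Vec WState k → Bool
anyOffline [] = false
anyOffline (online _ ∷ ws)  = anyOffline ws
anyOffline (offline _ ∷ ws) = true

noFlush : ∀ {k} → Fin k → Bool
noFlush _ = false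

flushAllW : ∀ {k} → Fin k → Bool
flushAllW _ = true

faDecideAux : ∀ {k} → Vec WState k → Maybe (Fin k) → Decision k
faDecideAux s (just i) = dec (just i) noFlush
faDecideAux s nothing  = dec nothing (if anyOffline s then noFlush else flushAllW)

-- first fit; if nothing fits: discard, and (unless we are inside the flush
-- period, when all wallets are offline) flush all k wallets
faDecide : ∀ {k} → Vec WState k → ℚ → Decision k
faDecide s v = faDecideAux s (firstFit s v)

flushAll : ∀ {k} → ℚ → ℕ → Vec WState k → List ℚ → List (Decision k)
flushAll W F s [] = []
flushAll W F s (v ∷ vs) = faDecide s v ∷ flushAll W F (step W F s v (faDecide s v)) vs

-- FlushAll alternates between active phases (all wallets online, filled first
-- fit) and flush phases (all wallets offline), and along every run
-- OPT ≤ 3 · FlushAll + Φ for a nonnegative potential Φ that is 0 at the start,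
-- so the additive constant is 0.  In an active phase Φ is twice the
-- collateral FlushAll has spent: a transaction of value v earns OPT at most v,
-- while FlushAll earns v and Φ grows by 2v.  When a transaction fits nowhere,
-- first fit guarantees that any two residuals sum to at most W = C/k, so with
-- k ≥ 2 wallets FlushAll has spent at least half of the capacity kW, i.e.
-- Φ ≥ kW.  This pays for everything OPT settles until FlushAll's wallets come
-- back: at most one wallet's worth W per OPT wallet.
module Submission where

open import Defs
open import Data.Rational using (ℚ; 0ℚ; _+_; _*_; _≤_; _<_; _/_)
open import Data.Integer using (+_)
open import Data.Nat as ℕ using (ℕ; NonZero)
open import Data.List using (List)
open import Data.List.Relation.Unary.All using (All)
open import Data.Product using (Σ; _×_)

open import Data.Bool using (Bool; true; false; if_then_else_)
open import Data.Empty using (⊥-elim)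
open import Data.Fin using (Fin; zero; suc)
open import Data.List using ([]; _∷_)
open import Data.List.Relation.Unary.All using ([]; _∷_)
open import Data.Maybe as Maybe using (Maybe; just; nothing)
open import Data.Nat using (zero; suc)
import Data.Nat.Properties as ℕ
open import Data.Product using (_,_; proj₁)
open import Data.Rational using (-_; _-_; _≤?_)
open import Data.Rational.Properties
  using ( ≤-refl; ≤-reflexive; ≤-trans; ≤-total; <⇒≤; <-≤-trans; <-irrefl; ≰⇒>
        ; +-mono-≤; +-monoˡ-≤; +-monoʳ-≤; neg-antimono-≤
        ; +-assoc; +-identityˡ; +-identityʳ; +-inverseʳ
        ; nonNegative⁻¹; nonNeg*nonNeg⇒nonNeg; normalize-nonNeg
        ; module ≤-Reasoning )
open import Data.Rational.Solver using (module +-*-Solver)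
import Data.Rational as ℚ
open import Data.Sum using (_⊎_; inj₁; inj₂)
open import Data.Unit using (⊤; tt)
open import Data.Vec using (Vec; []; _∷_; map; replicate; zipWith; tabulate; updateAt; lookup; foldr′)
open import Data.Vec.Properties using (map-const; map-cong; map-∘; map-replicate; zipWith-replicate₁)
open import Data.Vec.Relation.Unary.All as Allᵥ using ([]; _∷_) renaming (All to Allᵥ)
import Data.Vec.Relation.Unary.All.Properties as Allᵥ
open import Data.Vec.Relation.Unary.AllPairs as AllPairs using (AllPairs; []; _∷_)
import Data.Vec.Relation.Unary.AllPairs.Properties as AllPairs
open import Function using (const)
open import Relation.Binary.PropositionalEquality
  using (_≡_; refl; sym; trans; cong; cong₂; subst; module ≡-Reasoning)
open import Relation.Nullary using (yes; no)
open +-*-Solver using (solve; _:+_; _:-_; _:*_; _:=_; con)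

p≤q⇒0≤q-p : ∀ {p q} → p ≤ q → 0ℚ ≤ q - p
p≤q⇒0≤q-p {p} {q} p≤q = begin
  0ℚ     ≡⟨ sym (+-inverseʳ p) ⟩
  p - p  ≤⟨ +-monoˡ-≤ (- p) p≤q ⟩
  q - p  ∎
  where open ≤-Reasoning

p-q≤p : ∀ p {q} → 0ℚ ≤ q → p - q ≤ p
p-q≤p p {q} 0≤q = begin
  p - q   ≤⟨ +-monoʳ-≤ p (neg-antimono-≤ 0≤q) ⟩
  p + 0ℚ  ≡⟨ +-identityʳ p ⟩
  p       ∎
  where open ≤-Reasoning

amortise : ∀ α {g a f x p p′} → a ≤ α * x + p′ → g + p′ ≤ α * f + p →
           g + a ≤ α * (f + x) + p
amortise α {g} {a} {f} {x} {p} {p′} a≤ g+p′≤ = begin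
  g + a                ≤⟨ +-monoʳ-≤ g a≤ ⟩
  g + (α * x + p′)     ≡⟨ regroup g (α * x) p′ ⟩
  (g + p′) + α * x     ≤⟨ +-monoˡ-≤ (α * x) g+p′≤ ⟩
  (α * f + p) + α * x  ≡⟨ distribute α f x p ⟩
  α * (f + x) + p      ∎
  where
  open ≤-Reasoning
  regroup : ∀ g y p′ → g + (y + p′) ≡ (g + p′) + y
  regroup = solve 3 (λ g y p′ → g :+ (y :+ p′) := (g :+ p′) :+ y) refl
  distribute : ∀ α f x p → (α * f + p) + α * x ≡ α * (f + x) + p
  distribute = solve 4 (λ α f x p → (α :* f :+ p) :+ α :* x := α :* (f :+ x) :+ p) refl

sum : ∀ {n} → Vec ℚ n → ℚ
sum = foldr′ _+_ 0ℚ

sum-nonneg : ∀ {n} {xs : Vec ℚ n} → Allᵥ (0ℚ ≤_) xs → 0ℚ ≤ sum xs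
sum-nonneg []           = ≤-refl
sum-nonneg (0≤x ∷ 0≤xs) = +-mono-≤ 0≤x (sum-nonneg 0≤xs)

sum-map-mono : ∀ {A : Set} {f g : A → ℚ} {n} {xs : Vec A n} →
               Allᵥ (λ x → f x ≤ g x) xs → sum (map f xs) ≤ sum (map g xs)
sum-map-mono []            = ≤-refl
sum-map-mono (fx≤gx ∷ f≤g) = +-mono-≤ fx≤gx (sum-map-mono f≤g)

sum-map-+ : ∀ {A : Set} (f g : A → ℚ) {n} (xs : Vec A n) →
            sum (map (λ x → f x + g x) xs) ≡ sum (map f xs) + sum (map g xs)
sum-map-+ f g []       = refl
sum-map-+ f g (x ∷ xs) = trans (cong (_+_ (f x + g x)) (sum-map-+ f g xs)) (interchange (f x) (g x) _ _)
  where
  interchange : ∀ a b c d → (a + b) + (c + d) ≡ (a + c) + (b + d)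
  interchange = solve 4 (λ a b c d → (a :+ b) :+ (c :+ d) := (a :+ c) :+ (b :+ d)) refl

-- If x ≤ 0, every other element is at least -x ≥ 0; otherwise drop x and recurse.
pairwise-nonneg⇒sum-nonneg : ∀ {n} {xs : Vec ℚ (suc (suc n))} →
                              AllPairs (λ x y → 0ℚ ≤ x + y) xs → 0ℚ ≤ sum xs
pairwise-nonneg⇒sum-nonneg {zero} {x ∷ y ∷ []} ((0≤x+y ∷ []) ∷ _) =
  subst (λ t → 0ℚ ≤ x + t) (sym (+-identityʳ y)) 0≤x+y
pairwise-nonneg⇒sum-nonneg {suc n} {x ∷ y ∷ zs} ((0≤x+y ∷ 0≤x+zs) ∷ pairs) with ≤-total 0ℚ x
... | inj₁ 0≤x = +-mono-≤ 0≤x (pairwise-nonneg⇒sum-nonneg pairs)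
... | inj₂ x≤0 = begin
  0ℚ
    ≤⟨ +-mono-≤ 0≤x+y (sum-nonneg (Allᵥ.map (λ {z} 0≤x+z → ≤-trans 0≤x+z (x+z≤z z)) 0≤x+zs)) ⟩
  (x + y) + sum zs
    ≡⟨ +-assoc x y (sum zs) ⟩
  x + (y + sum zs) ∎
  where
  open ≤-Reasoning
  x+z≤z : ∀ z → x + z ≤ z
  x+z≤z z = ≤-trans (+-monoˡ-≤ z x≤0) (≤-reflexive (+-identityˡ z))

Allᵥ-replicate⁺ : ∀ {A : Set} {P : A → Set} {x} n → P x → Allᵥ P (replicate n x)
Allᵥ-replicate⁺ zero    px = []
Allᵥ-replicate⁺ (suc n) px = px ∷ Allᵥ-replicate⁺ n px

Allᵥ-updateAt⁺ : ∀ {A : Set} {P : A → Set} {f : A → A} {n} {xs : Vec A n} (i : Fin n) →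
                 (∀ {x} → P x → P (f x)) → Allᵥ P xs → Allᵥ P (updateAt xs i f)
Allᵥ-updateAt⁺ zero    pf (px ∷ pxs) = pf px ∷ pxs
Allᵥ-updateAt⁺ (suc i) pf (px ∷ pxs) = px ∷ Allᵥ-updateAt⁺ i pf pxs

tabulate-const : ∀ {A : Set} {n} (x : A) → tabulate {n = n} (λ _ → x) ≡ replicate n x
tabulate-const {n = zero}  x = refl
tabulate-const {n = suc n} x = cong (x ∷_) (tabulate-const x)

Bounded : ℚ → ℚ → Set
Bounded W x = 0ℚ ≤ x × x ≤ W

WalletBounded : ℚ → WState → Set
WalletBounded W (online R)  = Bounded W R
WalletBounded W (offline _) = ⊤

gain≤ : ∀ {k v} (o : Maybe (Fin k)) → 0ℚ ≤ v → gain v o ≤ v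
gain≤ nothing  0≤v = 0≤v
gain≤ (just _) 0≤v = ≤-refl

settleAt-bounded : ∀ {W k v} {s : Vec WState k} (i : Fin k) → 0ℚ ≤ v →
                   Allᵥ (WalletBounded W) s → Fits v (lookup s i) →
                   Allᵥ (WalletBounded W) (settleAt s i v)
settleAt-bounded {s = online R ∷ _} zero 0≤v ((0≤R , R≤W) ∷ bs) v≤R =
  (p≤q⇒0≤q-p v≤R , ≤-trans (p-q≤p R 0≤v) R≤W) ∷ bs
settleAt-bounded {s = offline _ ∷ _} zero 0≤v bs ()
settleAt-bounded (suc i) 0≤v (b ∷ bs) fits = b ∷ settleAt-bounded i 0≤v bs fits

applySettle-bounded : ∀ {W k v} {s : Vec WState k} (o : Maybe (Fin k)) → 0ℚ ≤ v →
                      Allᵥ (WalletBounded W) s → ValidSettle s v o →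
                      Allᵥ (WalletBounded W) (applySettle s v o)
applySettle-bounded nothing  0≤v bs _     = bs
applySettle-bounded (just i) 0≤v bs fits = settleAt-bounded i 0≤v bs fits

endSlot-bounded : ∀ {W} F b w → 0ℚ ≤ W → WalletBounded W w → WalletBounded W (endSlot W F b w)
endSlot-bounded F true  w                       0≤W _  = tt
endSlot-bounded F false (online R)              0≤W bw = bw
endSlot-bounded F false (offline zero)          0≤W _  = 0≤W , ≤-refl
endSlot-bounded F false (offline (suc zero))    0≤W _  = 0≤W , ≤-refl
endSlot-bounded F false (offline (suc (suc m))) 0≤W _  = tt

step-bounded : ∀ {W F k v} {s : Vec WState k} (d : Decision k) → 0ℚ ≤ W → 0ℚ ≤ v →
               Allᵥ (WalletBounded W) s → ValidSettle s v (settle d) →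
               Allᵥ (WalletBounded W) (step W F s v d)
step-bounded {F = F} d 0≤W 0≤v bs valid =
  Allᵥ.zipWith (λ {b} {w} _ → endSlot-bounded F b w 0≤W)
               (Allᵥ.universal (λ _ → tt) (tabulate (flush d)))
               (applySettle-bounded (settle d) 0≤v bs valid)

step-constFlush : ∀ {W F k} (s : Vec WState k) v o b →
                  step W F s v (dec o (λ _ → b)) ≡ map (endSlot W F b) (applySettle s v o)
step-constFlush {W} {F} s v o b =
  trans (cong (λ bs → zipWith (endSlot W F) bs (applySettle s v o)) (tabulate-const b))
        (zipWith-replicate₁ (endSlot W F) b (applySettle s v o))

-- While FlushAll's wallets are offline for the current slot and the next m,
-- reserve W m w bounds what OPT can still settle with wallet w: its residual
-- if online, a full refill if it comes back before FlushAll does.  No wallet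
-- refills twice, since a flush lasts F > m slots.
reserve : ℚ → ℕ → WState → ℚ
reserve W m (online R)   = R
reserve W m (offline m′) = if m′ ℕ.≤ᵇ m then W else 0ℚ

flushPotential : ∀ {k} → ℚ → ℕ → Vec WState k → ℚ
flushPotential W m s = sum (map (reserve W m) s)

reserve-nonneg : ∀ {W} m w → 0ℚ ≤ W → WalletBounded W w → 0ℚ ≤ reserve W m w
reserve-nonneg m (online R)   0≤W (0≤R , _) = 0≤R
reserve-nonneg m (offline m′) 0≤W _ with m′ ℕ.≤ᵇ m
... | true  = 0≤W
... | false = ≤-refl

reserve≤capacity : ∀ {W} m w → 0ℚ ≤ W → WalletBounded W w → reserve W m w ≤ W
reserve≤capacity m (online R)   0≤W (_ , R≤W) = R≤W
reserve≤capacity m (offline m′) 0≤W _ with m′ ℕ.≤ᵇ m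
... | true  = ≤-refl
... | false = 0≤W

reserve-endSlot : ∀ {W F m} b w → m ℕ.< F → 0ℚ ≤ W → WalletBounded W w →
                  reserve W m (endSlot W F b w) ≤ reserve W (suc m) w
reserve-endSlot {F = F} {m} true w m<F 0≤W bw with F ℕ.≤ᵇ m | ℕ.≤ᵇ⇒≤ F m
... | true  | F≤m = ⊥-elim (ℕ.<⇒≱ m<F (F≤m tt))
... | false | _   = reserve-nonneg (suc m) w 0≤W bw
reserve-endSlot false (online R)              m<F 0≤W _ = ≤-refl
reserve-endSlot false (offline zero)          m<F 0≤W _ = ≤-refl
reserve-endSlot false (offline (suc zero))    m<F 0≤W _ = ≤-refl
reserve-endSlot false (offline (suc (suc _))) m<F 0≤W _ = ≤-refl

flushPotential-nonneg : ∀ {W k} m {s : Vec WState k} → 0ℚ ≤ W → Allᵥ (WalletBounded W) s →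
                        0ℚ ≤ flushPotential W m s
flushPotential-nonneg m 0≤W bs =
  sum-nonneg (Allᵥ.map⁺ (Allᵥ.map (λ {w} → reserve-nonneg m w 0≤W) bs))

flushPotential≤capacity : ∀ {W k} m {s : Vec WState k} → 0ℚ ≤ W → Allᵥ (WalletBounded W) s →
                          flushPotential W m s ≤ sum (replicate k W)
flushPotential≤capacity {W} m {s} 0≤W bs =
  ≤-trans (sum-map-mono (Allᵥ.map (λ {w} → reserve≤capacity m w 0≤W) bs))
          (≤-reflexive (cong sum (map-const s W)))

flushPotential-settleAt : ∀ {W k v} m (s : Vec WState k) (i : Fin k) → Fits v (lookup s i) →
                          v + flushPotential W m (settleAt s i v) ≡ flushPotential W m s
flushPotential-settleAt {W} {v = v} m (online R ∷ s) zero v≤R = cancel v R (flushPotential W m s)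
  where
  cancel : ∀ v R p → v + ((R - v) + p) ≡ R + p
  cancel = solve 3 (λ v R p → v :+ ((R :- v) :+ p) := R :+ p) refl
flushPotential-settleAt m (offline _ ∷ s) zero ()
flushPotential-settleAt {W} {v = v} m (w ∷ s) (suc i) fits =
  trans (swap v (reserve W m w) _) (cong (_+_ (reserve W m w)) (flushPotential-settleAt m s i fits))
  where
  swap : ∀ v r p → v + (r + p) ≡ r + (v + p)
  swap = solve 3 (λ v r p → v :+ (r :+ p) := r :+ (v :+ p)) refl

flushPotential-applySettle : ∀ {W k v} m (s : Vec WState k) (o : Maybe (Fin k)) → ValidSettle s v o →
                             gain v o + flushPotential W m (applySettle s v o) ≡ flushPotential W m s
flushPotential-applySettle m s nothing  _    = +-identityˡ _
flushPotential-applySettle m s (just i) fits = flushPotential-settleAt m s i fits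

flushPotential-endSlot : ∀ {W F k m} (bs : Vec Bool k) {s : Vec WState k} → m ℕ.< F → 0ℚ ≤ W →
                         Allᵥ (WalletBounded W) s →
                         flushPotential W m (zipWith (endSlot W F) bs s) ≤ flushPotential W (suc m) s
flushPotential-endSlot []       m<F 0≤W []        = ≤-refl
flushPotential-endSlot (b ∷ bs) {w ∷ _} m<F 0≤W (bw ∷ bws) =
  +-mono-≤ (reserve-endSlot b w m<F 0≤W bw) (flushPotential-endSlot bs m<F 0≤W bws)

flushPotential-step : ∀ {W F k m v} {s : Vec WState k} (d : Decision k) → m ℕ.< F →
                      0ℚ ≤ W → 0ℚ ≤ v → Allᵥ (WalletBounded W) s → ValidSettle s v (settle d) →
                      gain v (settle d) + flushPotential W m (step W F s v d) ≤ flushPotential W (suc m) s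
flushPotential-step {W} {F} {m = m} {v} {s} d m<F 0≤W 0≤v bs valid = begin
  gain v (settle d) + flushPotential W m (step W F s v d)
    ≤⟨ +-monoʳ-≤ (gain v (settle d)) (flushPotential-endSlot (tabulate (flush d)) m<F 0≤W settled) ⟩
  gain v (settle d) + flushPotential W (suc m) (applySettle s v (settle d))
    ≡⟨ flushPotential-applySettle (suc m) s (settle d) valid ⟩
  flushPotential W (suc m) s ∎
  where
  open ≤-Reasoning
  settled = applySettle-bounded (settle d) 0≤v bs valid

gain≤flushPotential : ∀ {W k v} m {s : Vec WState k} (o : Maybe (Fin k)) → 0ℚ ≤ W → 0ℚ ≤ v →
                      Allᵥ (WalletBounded W) s → ValidSettle s v o → gain v o ≤ flushPotential W m s
gain≤flushPotential {W} {v = v} m {s} o 0≤W 0≤v bs valid = begin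
  gain v o                                          ≡⟨ +-identityʳ (gain v o) ⟨
  gain v o + 0ℚ                                     ≤⟨ +-monoʳ-≤ (gain v o) (flushPotential-nonneg m 0≤W settled) ⟩
  gain v o + flushPotential W m (applySettle s v o) ≡⟨ flushPotential-applySettle m s o valid ⟩
  flushPotential W m s                              ∎
  where
  open ≤-Reasoning
  settled = applySettle-bounded o 0≤v bs valid

activePotential : ∀ {k} → ℚ → Vec ℚ k → ℚ
activePotential W rs = sum (map (λ R → (W - R) + (W - R)) rs)

activePotential-nonneg : ∀ {W k} {rs : Vec ℚ k} → Allᵥ (_≤ W) rs → 0ℚ ≤ activePotential W rs
activePotential-nonneg rs≤W =
  sum-nonneg (Allᵥ.map⁺ (Allᵥ.map (λ R≤W → +-mono-≤ (p≤q⇒0≤q-p R≤W) (p≤q⇒0≤q-p R≤W)) rs≤W))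

activePotential-replicate : ∀ W k → activePotential W (replicate k W) ≡ 0ℚ
activePotential-replicate W zero    = refl
activePotential-replicate W (suc k) =
  cong₂ _+_ (cong₂ _+_ (+-inverseʳ W) (+-inverseʳ W)) (activePotential-replicate W k)

activePotential-updateAt : ∀ {W k} (rs : Vec ℚ k) i v →
                           activePotential W (updateAt rs i (_- v)) ≡ activePotential W rs + (v + v)
activePotential-updateAt {W} (R ∷ rs) zero v = spend W R v (activePotential W rs)
  where
  spend : ∀ W R v p → ((W - (R - v)) + (W - (R - v))) + p ≡ (((W - R) + (W - R)) + p) + (v + v)
  spend = solve 4 (λ W R v p → ((W :- (R :- v)) :+ (W :- (R :- v))) :+ p
                             := (((W :- R) :+ (W :- R)) :+ p) :+ (v :+ v)) refl
activePotential-updateAt {W} (R ∷ rs) (suc i) v =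
  trans (cong (_+_ ((W - R) + (W - R))) (activePotential-updateAt {W} rs i v))
        (sym (+-assoc ((W - R) + (W - R)) (activePotential W rs) (v + v)))

-- activePotential W rs = kW + Σ (W - 2R), and the slacks W - 2R have pairwise
-- nonnegative sums.
capacity≤activePotential : ∀ {W n} {rs : Vec ℚ (suc (suc n))} → AllPairs (λ a b → a + b ≤ W) rs →
                           sum (replicate (suc (suc n)) W) ≤ activePotential W rs
capacity≤activePotential {W} {n} {rs} pairs = begin
  capacity                                     ≡⟨ +-identityʳ capacity ⟨
  capacity + 0ℚ                                ≤⟨ +-monoʳ-≤ capacity slack-nonneg ⟩
  capacity + sum (map slack rs)                ≡⟨ cong (λ t → sum t + sum (map slack rs)) (map-const rs W) ⟨
  sum (map (const W) rs) + sum (map slack rs)  ≡⟨ sum-map-+ (const W) slack rs ⟨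
  sum (map (λ R → W + slack R) rs)             ≡⟨ cong sum (map-cong (unslack W) rs) ⟩
  activePotential W rs                         ∎
  where
  open ≤-Reasoning
  capacity = sum (replicate (suc (suc n)) W)
  slack : ℚ → ℚ
  slack R = W - (R + R)
  slack-sum : ∀ W a b → (W - (a + a)) + (W - (b + b)) ≡ (W - (a + b)) + (W - (a + b))
  slack-sum = solve 3 (λ W a b → (W :- (a :+ a)) :+ (W :- (b :+ b))
                              := (W :- (a :+ b)) :+ (W :- (a :+ b))) refl
  slack-pair : ∀ {a b} → a + b ≤ W → 0ℚ ≤ slack a + slack b
  slack-pair {a} {b} a+b≤W =
    subst (0ℚ ≤_) (sym (slack-sum W a b)) (+-mono-≤ (p≤q⇒0≤q-p a+b≤W) (p≤q⇒0≤q-p a+b≤W))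
  slack-nonneg : 0ℚ ≤ sum (map slack rs)
  slack-nonneg =
    pairwise-nonneg⇒sum-nonneg (AllPairs.map⁺ (AllPairs.map (λ {a} {b} → slack-pair {a} {b}) pairs))
  unslack : ∀ W R → W + (W - (R + R)) ≡ (W - R) + (W - R)
  unslack = solve 2 (λ W R → W :+ (W :- (R :+ R)) := (W :- R) :+ (W :- R)) refl

-- The first-fit invariant for residuals a (earlier wallet) and b (later
-- wallet): b is still untouched, or b has only received transactions that
-- did not fit into a, which leaves a + b ≤ W.
FirstFitPair : ℚ → ℚ → ℚ → Set
FirstFitPair W a b = b ≡ W ⊎ a + b ≤ W

data FirstFit (v : ℚ) : ∀ {k} → Vec ℚ k → Maybe (Fin k) → Set where
  fitsHere    : ∀ {k R} {rs : Vec ℚ k} → v ≤ R → FirstFit v (R ∷ rs) (just zero)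
  fitsLater   : ∀ {k R i} {rs : Vec ℚ k} → R < v → FirstFit v rs (just i) →
                FirstFit v (R ∷ rs) (just (suc i))
  fitsNowhere : ∀ {k} {rs : Vec ℚ k} → Allᵥ (_< v) rs → FirstFit v rs nothing

firstFit-online : ∀ {k} (rs : Vec ℚ k) v → FirstFit v rs (firstFit (map online rs) v)
firstFit-online []       v = fitsNowhere []
firstFit-online (R ∷ rs) v with v ≤? R
... | yes v≤R = fitsHere v≤R
... | no  v≰R with firstFit (map online rs) v | firstFit-online rs v
...   | just i  | fit               = fitsLater (≰⇒> v≰R) fit
...   | nothing | fitsNowhere below = fitsNowhere (≰⇒> v≰R ∷ below)

settleAt-online : ∀ {k} (rs : Vec ℚ k) i v →
                  settleAt (map online rs) i v ≡ map online (updateAt rs i (_- v))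
settleAt-online (R ∷ rs) zero    v = refl
settleAt-online (R ∷ rs) (suc i) v = cong (online R ∷_) (settleAt-online rs i v)

firstFit-preserves-pairs : ∀ {W k v i} {rs : Vec ℚ k} → 0ℚ ≤ v → FirstFit v rs (just i) →
                           AllPairs (FirstFitPair W) rs → AllPairs (FirstFitPair W) (updateAt rs i (_- v))
firstFit-preserves-pairs {W} {v = v} {rs = R ∷ _} 0≤v (fitsHere _) (R~rs ∷ pairs) =
  Allᵥ.map shrink-earlier R~rs ∷ pairs
  where
  shrink-earlier : ∀ {b} → FirstFitPair W R b → FirstFitPair W (R - v) b
  shrink-earlier (inj₁ b≡W)       = inj₁ b≡W
  shrink-earlier {b} (inj₂ R+b≤W) = inj₂ (≤-trans (+-monoˡ-≤ b (p-q≤p R 0≤v)) R+b≤W)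
firstFit-preserves-pairs {W} {v = v} {suc i} {R ∷ _} 0≤v (fitsLater R<v fit) (R~rs ∷ pairs) =
  Allᵥ-updateAt⁺ i shrink-later R~rs ∷ firstFit-preserves-pairs 0≤v fit pairs
  where
  open ≤-Reasoning
  cancel : ∀ v W → v + (W - v) ≡ W
  cancel = solve 2 (λ v W → v :+ (W :- v) := W) refl
  shrink-later : ∀ {b} → FirstFitPair W R b → FirstFitPair W R (b - v)
  shrink-later (inj₁ refl) = inj₂ (begin
    R + (W - v)  ≤⟨ +-monoˡ-≤ (W - v) (<⇒≤ R<v) ⟩
    v + (W - v)  ≡⟨ cancel v W ⟩
    W            ∎)
  shrink-later {b} (inj₂ R+b≤W) = inj₂ (≤-trans (+-monoʳ-≤ R (p-q≤p b 0≤v)) R+b≤W)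

nothingFits⇒pairs≤capacity : ∀ {W k v} {rs : Vec ℚ k} → v ≤ W → Allᵥ (_< v) rs →
                              AllPairs (FirstFitPair W) rs → AllPairs (λ a b → a + b ≤ W) rs
nothingFits⇒pairs≤capacity v≤W [] [] = []
nothingFits⇒pairs≤capacity {W} {v = v} {a ∷ _} v≤W (_ ∷ rs<v) (a~rs ∷ pairs) =
  Allᵥ.map used (Allᵥ.zip (a~rs , rs<v)) ∷ nothingFits⇒pairs≤capacity v≤W rs<v pairs
  where
  used : ∀ {b} → FirstFitPair W a b × b < v → a + b ≤ W
  used (inj₁ refl , W<v) = ⊥-elim (<-irrefl refl (<-≤-trans W<v v≤W))
  used (inj₂ a+b≤W , _)  = a+b≤W

anyOffline-online : ∀ {k} (rs : Vec ℚ k) → anyOffline (map online rs) ≡ false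
anyOffline-online []       = refl
anyOffline-online (R ∷ rs) = anyOffline-online rs

firstFit-offline : ∀ k m v → firstFit (replicate k (offline m)) v ≡ nothing
firstFit-offline zero    m v = refl
firstFit-offline (suc k) m v = cong (Maybe.map suc) (firstFit-offline k m v)

step-fits : ∀ {W F k} (rs : Vec ℚ k) i v →
            step W F (map online rs) v (dec (just i) noFlush) ≡ map online (updateAt rs i (_- v))
step-fits {W} {F} rs i v = begin
  step W F (map online rs) v (dec (just i) noFlush)  ≡⟨ step-constFlush (map online rs) v (just i) false ⟩
  map (tick W) (settleAt (map online rs) i v)       ≡⟨ cong (map (tick W)) (settleAt-online rs i v) ⟩
  map (tick W) (map online rs′)                      ≡⟨ map-∘ (tick W) online rs′ ⟨
  map online rs′                                     ∎
  where
  open ≡-Reasoning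
  rs′ = updateAt rs i (_- v)

step-flushAll : ∀ {W F k} (s : Vec WState k) v →
                step W F s v (dec nothing flushAllW) ≡ replicate k (offline F)
step-flushAll {F = F} s v = trans (step-constFlush s v nothing true) (map-const s (offline F))

step-offline : ∀ {W F} k m v →
               step W F (replicate k (offline m)) v (dec nothing noFlush) ≡ replicate k (tick W (offline m))
step-offline {W} k m v =
  trans (step-constFlush (replicate k (offline m)) v nothing false) (map-replicate (tick W) (offline m) k)

module FlushAllAnalysis {W : ℚ} (0≤W : 0ℚ ≤ W) (k F′ : ℕ) where

  K F : ℕ
  K = suc (suc k)
  F = suc F′

  data Phase : Set where
    active   : Vec ℚ K → Phase
    flushing : ℕ → Phase

  ⟦_⟧ : Phase → Vec WState K
  ⟦ active rs  ⟧ = map online rs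
  ⟦ flushing m ⟧ = replicate K (offline (suc m))

  Invariant : Phase → Set
  Invariant (active rs)  = Allᵥ (_≤ W) rs × AllPairs (FirstFitPair W) rs
  Invariant (flushing m) = m ℕ.< F

  Φ : Phase → Vec WState K → ℚ
  Φ (active rs)  _ = activePotential W rs
  Φ (flushing m) s = flushPotential W m s

  Φ-nonneg : ∀ p {s} → Invariant p → Allᵥ (WalletBounded W) s → 0ℚ ≤ Φ p s
  Φ-nonneg (active rs)  (rs≤W , _) _  = activePotential-nonneg rs≤W
  Φ-nonneg (flushing m) _          bs = flushPotential-nonneg m 0≤W bs

  fresh : Phase
  fresh = active (replicate K W)

  fresh-invariant : Invariant fresh
  fresh-invariant = Allᵥ-replicate⁺ K ≤-refl , untouched K
    where
    untouched : ∀ n → AllPairs (FirstFitPair W) (replicate n W)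
    untouched zero    = []
    untouched (suc n) = Allᵥ-replicate⁺ n (inj₁ refl) ∷ untouched n

  ⟦fresh⟧ : ⟦ fresh ⟧ ≡ initial K W
  ⟦fresh⟧ = map-replicate online W K

  record Amortised (p : Phase) (e : Decision K) (s : Vec WState K) (v : ℚ) (d : Decision K) : Set where
    field
      next           : Phase
      next-invariant : Invariant next
      step-next      : step W F ⟦ p ⟧ v e ≡ ⟦ next ⟧
      potential-drop : gain v (settle d) + Φ next (step W F s v d) ≤ (+ 3) / 1 * gain v (settle e) + Φ p s

  fits-step : ∀ {rs s v d i} → FirstFit v rs (just i) → 0ℚ ≤ v → Invariant (active rs) →
              Amortised (active rs) (dec (just i) noFlush) s v d
  fits-step {rs} {s} {v} {d} {i} fit 0≤v (rs≤W , pairs) = record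
    { next           = active (updateAt rs i (_- v))
    ; next-invariant = Allᵥ-updateAt⁺ i (≤-trans (p-q≤p _ 0≤v)) rs≤W
                     , firstFit-preserves-pairs 0≤v fit pairs
    ; step-next      = step-fits rs i v
    ; potential-drop = begin
        gain v (settle d) + activePotential W (updateAt rs i (_- v))
          ≡⟨ cong (_+_ (gain v (settle d))) (activePotential-updateAt {W} rs i v) ⟩
        gain v (settle d) + (activePotential W rs + (v + v))
          ≤⟨ +-monoˡ-≤ _ (gain≤ (settle d) 0≤v) ⟩
        v + (activePotential W rs + (v + v))
          ≡⟨ triple v (activePotential W rs) ⟩
        (+ 3) / 1 * v + activePotential W rs ∎ }
    where
    open ≤-Reasoning
    triple : ∀ v p → v + (p + (v + v)) ≡ (+ 3) / 1 * v + p
    triple = solve 2 (λ v p → v :+ (p :+ (v :+ v)) := con ((+ 3) / 1) :* v :+ p) refl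

  reject-step : ∀ {rs s v d} → Allᵥ (_< v) rs → Bounded W v → Invariant (active rs) →
                Allᵥ (WalletBounded W) s → ValidSettle s v (settle d) →
                Amortised (active rs) (dec nothing flushAllW) s v d
  reject-step {rs} {s} {v} {d} below (0≤v , v≤W) (_ , pairs) bs valid = record
    { next           = flushing F′
    ; next-invariant = ℕ.n<1+n F′
    ; step-next      = step-flushAll (map online rs) v
    ; potential-drop = begin
        gain v (settle d) + flushPotential W F′ (step W F s v d)
          ≤⟨ flushPotential-step d (ℕ.n<1+n F′) 0≤W 0≤v bs valid ⟩
        flushPotential W F s
          ≤⟨ flushPotential≤capacity F 0≤W bs ⟩
        sum (replicate K W)
          ≤⟨ capacity≤activePotential (nothingFits⇒pairs≤capacity v≤W below pairs) ⟩
        activePotential W rs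
          ≡⟨ +-identityˡ _ ⟨
        (+ 3) / 1 * 0ℚ + activePotential W rs ∎ }
    where open ≤-Reasoning

  countdown-step : ∀ {m s v d} → Invariant (flushing (suc m)) → 0ℚ ≤ v →
                   Allᵥ (WalletBounded W) s → ValidSettle s v (settle d) →
                   Amortised (flushing (suc m)) (dec nothing noFlush) s v d
  countdown-step {m} {s} {v} {d} 1+m<F 0≤v bs valid = record
    { next           = flushing m
    ; next-invariant = m<F
    ; step-next      = step-offline K (suc (suc m)) v
    ; potential-drop = begin
        gain v (settle d) + flushPotential W m (step W F s v d)
          ≤⟨ flushPotential-step d m<F 0≤W 0≤v bs valid ⟩
        flushPotential W (suc m) s
          ≡⟨ +-identityˡ _ ⟨
        (+ 3) / 1 * 0ℚ + flushPotential W (suc m) s ∎ }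
    where
    open ≤-Reasoning
    m<F : m ℕ.< F
    m<F = ℕ.<-trans (ℕ.n<1+n m) 1+m<F

  recover-step : ∀ {s v d} → 0ℚ ≤ v → Allᵥ (WalletBounded W) s → ValidSettle s v (settle d) →
                 Amortised (flushing 0) (dec nothing noFlush) s v d
  recover-step {s} {v} {d} 0≤v bs valid = record
    { next           = fresh
    ; next-invariant = fresh-invariant
    ; step-next      = trans (step-offline K 1 v) (sym ⟦fresh⟧)
    ; potential-drop = begin
        gain v (settle d) + activePotential W (replicate K W)
          ≡⟨ cong (_+_ (gain v (settle d))) (activePotential-replicate W K) ⟩
        gain v (settle d) + 0ℚ
          ≡⟨ +-identityʳ _ ⟩
        gain v (settle d)
          ≤⟨ gain≤flushPotential 0 (settle d) 0≤W 0≤v bs valid ⟩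
        flushPotential W 0 s
          ≡⟨ +-identityˡ _ ⟨
        (+ 3) / 1 * 0ℚ + flushPotential W 0 s ∎ }
    where open ≤-Reasoning

  amortised-step : ∀ p {s v d} → Invariant p → Allᵥ (WalletBounded W) s → Bounded W v →
                   ValidSettle s v (settle d) → Amortised p (faDecide ⟦ p ⟧ v) s v d
  amortised-step (active rs) {v = v} inv bs v∈ valid with firstFit (map online rs) v | firstFit-online rs v
  ... | just i  | fit               = fits-step fit (proj₁ v∈) inv
  ... | nothing | fitsNowhere below rewrite anyOffline-online rs = reject-step below v∈ inv bs valid
  amortised-step (flushing zero) {v = v} _ bs (0≤v , _) valid rewrite firstFit-offline K 1 v =
    recover-step 0≤v bs valid
  amortised-step (flushing (suc m)) {v = v} inv bs (0≤v , _) valid rewrite firstFit-offline K (suc (suc m)) v =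
    countdown-step inv 0≤v bs valid

  potential-bound : ∀ p {s tx ds} → Invariant p → Allᵥ (WalletBounded W) s → All (Bounded W) tx →
                    Run W F s tx ds →
                    value W F s tx ds ≤ (+ 3) / 1 * value W F ⟦ p ⟧ tx (flushAll W F ⟦ p ⟧ tx) + Φ p s
  potential-bound p {s} inv bs [] [] = begin
    0ℚ                      ≤⟨ Φ-nonneg p inv bs ⟩
    Φ p s                   ≡⟨ +-identityˡ (Φ p s) ⟨
    (+ 3) / 1 * 0ℚ + Φ p s  ∎
    where open ≤-Reasoning
  potential-bound p {s} {v ∷ tx} {d ∷ ds} inv bs (v∈ ∷ tx∈) (valid ∷ run) =
    subst (λ σ → gain v (settle d) + value W F s′ tx ds
                   ≤ (+ 3) / 1 * (gain v (settle e) + value W F σ tx (flushAll W F σ tx)) + Φ p s)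
          (sym step-next)
          (amortise ((+ 3) / 1) {g = gain v (settle d)} {f = gain v (settle e)}
                    {x = value W F ⟦ next ⟧ tx (flushAll W F ⟦ next ⟧ tx)} {p = Φ p s} {p′ = Φ next s′}
                    (potential-bound next next-invariant (step-bounded d 0≤W (proj₁ v∈) bs valid) tx∈ run)
                    potential-drop)
    where
    e = faDecide ⟦ p ⟧ v
    s′ = step W F s v d
    open Amortised (amortised-step p {d = d} inv bs v∈ valid)

cap-nonneg : ∀ {C} k .{{_ : NonZero k}} → 0ℚ < C → 0ℚ ≤ cap C k
cap-nonneg {C} k 0<C = nonNegative⁻¹ (cap C k)
  {{nonNeg*nonNeg⇒nonNeg C {{ℚ.nonNegative (<⇒≤ 0<C)}} ((+ 1) / k) {{normalize-nonNeg 1 k}}}}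

theorem4 : (C : ℚ) (k F : ℕ) .{{_ : NonZero k}} → 0ℚ < C → 2 ℕ.≤ k → 1 ℕ.≤ F →
    Σ ℚ (λ c → (tx : List ℚ) → All (λ v → (0ℚ ≤ v) × (v ≤ cap C k)) tx →
      (ds : List (Decision k)) → Run (cap C k) F (initial k (cap C k)) tx ds →
      value (cap C k) F (initial k (cap C k)) tx ds
        ≤ ((+ 3) / 1) * value (cap C k) F (initial k (cap C k)) tx (flushAll (cap C k) F (initial k (cap C k)) tx) + c)
theorem4 C k@(suc (suc k′)) F@(suc F′) 0<C (ℕ.s≤s (ℕ.s≤s ℕ.z≤n)) (ℕ.s≤s ℕ.z≤n) =
  0ℚ , λ tx tx∈ ds run → begin
  value W F (initial k W) tx ds
    ≤⟨ potential-bound fresh fresh-invariant (Allᵥ-replicate⁺ k (0≤W , ≤-refl)) tx∈ run ⟩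
  (+ 3) / 1 * value W F ⟦ fresh ⟧ tx (flushAll W F ⟦ fresh ⟧ tx) + activePotential W (replicate k W)
    ≡⟨ cong₂ (λ σ c → (+ 3) / 1 * value W F σ tx (flushAll W F σ tx) + c)
             ⟦fresh⟧ (activePotential-replicate W k) ⟩
  (+ 3) / 1 * value W F (initial k W) tx (flushAll W F (initial k W) tx) + 0ℚ ∎
  where
  W = cap C k
  0≤W = cap-nonneg k 0<C
  open FlushAllAnalysis 0≤W k′ F′ hiding (K; F)
  open ≤-Reasoning
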